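{- For every simple temporal graph $\mathcal{G}=(V,E,\lambda)$ with lifetime $T_{\max}$ and any $\delta,k\in\mathbb{N}^+$, there is an algorithm that wins the temporal graph discovery game in the unknown-static-graph variation in $|V|\cdot T_{\max}$ rounds.
   Context: A simple temporal graph $\mathcal{G}=(V,E,\lambda)$ with lifetime $T_{\max}$ has a finite undirected static graph $(V,E)$ and labeling $\lambda:E\to\{1,\dots,T_{\max}\}$. Infection model with parameter $\delta$: all nodes start susceptible; a seed infection $(v,t)$ makes $v$ infected at time $t$; otherwise a susceptible node $u$ becomes infected at time $t$ iff some node $w$ infectious at time $t$ has an edge $uw$ with $\lambda(uw)=t$ (if several, exactly one infects $u$); a node infected at time $t$ is infectious at times $t+1,\dots,t+\delta$ and resistant afterwards. An infection log is the set of triples $(u,w,s)$ ($u$ infected $w$ at time $s$; seeds as $(u,u,s)$), consistent with a seed set if some chain with these seeds produces it. TGD game, unknown-static-graph variation: the Discoverer learns only the node set $V$; each round it submits at most $k$ seed infections and the Adversary answers with a consistent infection log; to end, the Discoverer submits a temporal graph (edges and labels) and the Adversary responds with a temporal graph consistent with all logs; the Adversary wins if they differ, otherwise the Discoverer wins. -}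

module Defs where

open import Data.Nat using (ℕ; zero; suc; _+_; _*_; _≤_; _<_)
open import Data.Fin using (Fin)
open import Data.List using (List; []; _∷_; length)
open import Data.List.Membership.Propositional using (_∈_)
open import Data.List.Relation.Unary.All using (All)
open import Data.Maybe using (Maybe; just; nothing)
open import Data.Product using (Σ; ∃; _×_; _,_; proj₁)
open import Data.Sum using (_⊎_; inj₁; inj₂)
open import Relation.Binary.PropositionalEquality using (_≡_)

-- An (undirected, simple) labelled edge set is encoded by a symmetric,
-- irreflexive partial labelling: label u v ≡ just t  iff  uv ∈ E and
-- λ(uv) = t;  label u v ≡ nothing iff uv ∉ E.

Labelling : ℕ → Set
Labelling n = Fin n → Fin n → Maybe ℕ

record TemporalGraph (n T : ℕ) : Set where
  field
    label   : Labelling n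
    symm    : ∀ u v → label u v ≡ label v u
    irrefl  : ∀ v → label v v ≡ nothing
    inRange : ∀ u v t → label u v ≡ just t → 1 ≤ t × t ≤ T
open TemporalGraph public

SameGraph : ∀ {n} → Labelling n → Labelling n → Set
SameGraph {n} ℓ₁ ℓ₂ = ∀ (u v : Fin n) → ℓ₁ u v ≡ ℓ₂ u v

Seed : ℕ → Set
Seed n = Fin n × ℕ

-- Since every node is infected at most once,
-- the set of triples (w , u , s) ("w infected u at time s", seeds as
-- (u , u , s)) is encoded as the partial function
--   log u ≡ just (w , s)   iff   (w , u , s) is in the log.
Log : ℕ → Set
Log n = Fin n → Maybe (Fin n × ℕ)

InfectedBy : ∀ {n} → Log n → Fin n → ℕ → Set
InfectedBy L u t = ∃ λ w → ∃ λ s → L u ≡ just (w , s) × s ≤ t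

Infectious : ∀ {n} → ℕ → Log n → Fin n → ℕ → Set
Infectious δ L w t = ∃ λ x → ∃ λ s → L w ≡ just (x , s) × s < t × t ≤ s + δ

-- The log L is produced by some chain of the infection process with
-- parameter δ on the temporal graph G started from the given seeds:
--  * every recorded infection has a legitimate cause at that very time
--    (a seed, or an edge labelled s to a node infectious at s);
--  * no node stays susceptible past a cause of infection (so each node
--    is infected exactly at the earliest time it has a cause, if any).
record Consistent {n T : ℕ} (δ : ℕ) (G : TemporalGraph n T)
                  (seeds : List (Seed n)) (L : Log n) : Set where
  field
    cause : ∀ u w s → L u ≡ just (w , s) →
              (w ≡ u × (u , s) ∈ seeds)
              ⊎ (Infectious δ L w s × label G u w ≡ just s)
    seedForces : ∀ u t → (u , t) ∈ seeds → InfectedBy L u t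
    edgeForces : ∀ u w t → Infectious δ L w t → label G u w ≡ just t →
                   InfectedBy L u t

Query : ℕ → ℕ → Set
Query n k = Σ (List (Seed n)) λ q → length q ≤ k

-- The history of previous rounds (most recent first).
History : ℕ → ℕ → Set
History n k = List (Query n k × Log n)

-- A Discoverer strategy (knows only n = |V|, plus the parameters):
-- from the history it either asks a new query or submits a final
-- temporal graph (an arbitrary labelling).
Discoverer : ℕ → ℕ → Set
Discoverer n k = History n k → Query n k ⊎ Labelling n

Adversary : ℕ → ℕ → Set
Adversary n k = History n k → Query n k → Log n

AnswersBy : ∀ {n T k} → ℕ → TemporalGraph n T → Adversary n k → Set
AnswersBy δ G α = ∀ h q → Consistent δ G (proj₁ q) (α h q)

play : ∀ {n k} → ℕ → Discoverer n k → Adversary n k → History n k →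
       Maybe (History n k × Labelling n)
play fuel σ α h with σ h
... | inj₂ g = just (h , g)
play zero σ α h | inj₁ q = nothing
play (suc f) σ α h | inj₁ q = play f σ α ((q , α h q) ∷ h)

ConsistentWithAll : ∀ {n T k} → ℕ → TemporalGraph n T → History n k → Set
ConsistentWithAll δ G' h = All (λ e → Consistent δ G' (proj₁ (proj₁ e)) (Data.Product.proj₂ e)) h

-- The Discoverer wins within `rounds` query rounds: it submits a graph after
-- at most `rounds` rounds, and every temporal graph (with lifetime T) that the
-- Adversary could reveal, i.e. any consistent with all logs, equals it.
WinsWithin : ∀ {n k} → ℕ → ℕ → ℕ → Discoverer n k → Adversary n k → Set
WinsWithin {n} {k} T δ rounds σ α =
  ∃ λ (res : History n k × Labelling n) →
    play rounds σ α [] ≡ just res ×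
    (∀ (G' : TemporalGraph n T) → ConsistentWithAll δ G' (proj₁ res) →
       SameGraph (Data.Product.proj₂ res) (label G'))

{-# OPTIONS --safe #-}
-- Seed each node v alone at each time t < T.  In a log consistent with the
-- single seed (v , t) nobody is infected before t and only v at t; since δ ≥ 1
-- keeps v infectious at t + 1, every u with λ(uv) = t + 1 is infected at t + 1,
-- and then necessarily by v.  Conversely, every non-seed infection of u by v at
-- time s in a consistent log witnesses λ(uv) = s.  Hence the labelling read off
-- the n · T logs agrees with every temporal graph consistent with them.
module Submission where

open import Defs
open import Data.Nat using (ℕ; zero; suc; _+_; _*_; _≤_; _<_; z≤n; s≤s; s≤s⁻¹)
open import Data.Nat.Properties using (≤-refl; <⇒≤; ≤-<-trans; <⇒≱; <-≤-trans; ≤-trans; m<m+n; m≤n⇒m<n∨m≡n)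
open import Data.Nat.Induction using (<-wellFounded)
open import Data.Fin using (Fin)
open import Data.Fin.Properties using (_≟_)
open import Data.List using (List; []; _∷_; length; map; drop; cartesianProduct; allFin; upTo)
open import Data.List.Properties using (length-++; length-map; length-tabulate; length-upTo)
open import Data.List.Membership.Propositional using (_∈_)
open import Data.List.Membership.Propositional.Properties using (∈-cartesianProduct⁺; ∈-allFin; ∈-upTo⁺)
open import Data.List.Relation.Unary.All using (_∷_)
open import Data.List.Relation.Unary.Any using (Any; here; there)
open import Data.Maybe using (Maybe; just; nothing; _<∣>_)
open import Data.Product using (Σ; _×_; _,_; proj₁)
open import Data.Sum using (_⊎_; inj₁; inj₂)
open import Induction.WellFounded using (Acc; acc)
open import Level using (Level)
open import Relation.Nullary using (yes; no; contradiction)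
open import Relation.Binary.PropositionalEquality using (_≡_; _≢_; refl; sym; trans; cong; cong₂; subst; module ≡-Reasoning)

private
  variable
    a b : Level
    A : Set a
    B : Set b
    n k T δ : ℕ

length-cartesianProduct : (xs : List A) (ys : List B) →
                          length (cartesianProduct xs ys) ≡ length xs * length ys
length-cartesianProduct []       ys = refl
length-cartesianProduct (x ∷ xs) ys = begin
  length (cartesianProduct (x ∷ xs) ys)
    ≡⟨ length-++ (map (x ,_) ys) ⟩
  length (map (x ,_) ys) + length (cartesianProduct xs ys)
    ≡⟨ cong₂ _+_ (length-map (x ,_) ys) (length-cartesianProduct xs ys) ⟩
  length ys + length xs * length ys ∎
  where open ≡-Reasoning

drop-suc-∷ : ∀ i {xs ys : List A} {y} → drop i xs ≡ y ∷ ys → drop (suc i) xs ≡ ys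
drop-suc-∷ zero    {_ ∷ _} refl = refl
drop-suc-∷ (suc i) {_ ∷ _} eq   = drop-suc-∷ i eq

play-submit : ∀ (σ : Discoverer n k) α {h g} f → σ h ≡ inj₂ g → play f σ α h ≡ just (h , g)
play-submit σ α {h} f eq with σ h
play-submit σ α f refl | _ = refl

play-query : ∀ (σ : Discoverer n k) α {h q} f → σ h ≡ inj₁ q →
             play (suc f) σ α h ≡ play f σ α ((q , α h q) ∷ h)
play-query σ α {h} f eq with σ h
play-query σ α f refl | _ = refl

label⇒≢ : (G : TemporalGraph n T) {u v : Fin n} {s : ℕ} → label G u v ≡ just s → u ≢ v
label⇒≢ G uv refl with () ← trans (sym uv) (irrefl G _)

module SingleSeed {G : TemporalGraph n T} {v : Fin n} {t : ℕ} {L : Log n}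
                  (C : Consistent δ G ((v , t) ∷ []) L) where
  open Consistent C

  seed-time≤ : ∀ {u w s} → L u ≡ just (w , s) → t ≤ s
  seed-time≤ {s = s} = go (<-wellFounded s)
    where
    go : ∀ {u w s} → Acc _<_ s → L u ≡ just (w , s) → t ≤ s
    go {u} {w} {s} (acc rs) eq with cause u w s eq
    ... | inj₁ (_ , here refl) = ≤-refl
    ... | inj₂ ((_ , _ , eq′ , s′<s , _) , _) = <⇒≤ (≤-<-trans (go (rs s′<s) eq′) s′<s)

  infected-by-seed-time⇒seed : ∀ {u w s} → L u ≡ just (w , s) → s ≤ t → u ≡ v
  infected-by-seed-time⇒seed {u} {w} {s} eq s≤t with cause u w s eq
  ... | inj₁ (_ , here refl) = refl
  ... | inj₂ ((_ , _ , eq′ , s′<s , _) , _) =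
    contradiction (seed-time≤ eq′) (<⇒≱ (<-≤-trans s′<s s≤t))

  infected-at-suc⇒by-seed : ∀ {u w} → L u ≡ just (w , suc t) → w ≡ v
  infected-at-suc⇒by-seed {u} {w} eq with cause u w (suc t) eq
  ... | inj₁ (_ , here ())
  ... | inj₂ ((_ , _ , eq′ , s′<1+t , _) , _) = infected-by-seed-time⇒seed eq′ (s≤s⁻¹ s′<1+t)

  seed-infectious : 1 ≤ δ → Infectious δ L v (suc t)
  seed-infectious 1≤δ with seedForces v t (here refl)
  ... | w , s , eq , s≤t = w , s , eq , s≤s s≤t , ≤-trans (s≤s (seed-time≤ eq)) (m<m+n s 1≤δ)

  neighbour-infected-by-seed : 1 ≤ δ → ∀ {u} → label G u v ≡ just (suc t) → L u ≡ just (v , suc t)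
  neighbour-infected-by-seed 1≤δ {u} uv with edgeForces u v (suc t) (seed-infectious 1≤δ) uv
  ... | w , s , eq , s≤1+t with m≤n⇒m<n∨m≡n s≤1+t
  ...   | inj₁ s<1+t = contradiction (infected-by-seed-time⇒seed eq (s≤s⁻¹ s<1+t)) (label⇒≢ G uv)
  ...   | inj₂ refl with refl ← infected-at-suc⇒by-seed eq = eq

transmissionTime : Log n → Fin n → Fin n → Maybe ℕ
transmissionTime L u v with L u
... | nothing = nothing
... | just (w , s) with w ≟ v | u ≟ v
...   | yes _ | no _ = just s
...   | _     | _    = nothing

transmissionTime-sound : ∀ {G : TemporalGraph n T} {seeds L u v s} → Consistent δ G seeds L →
                         transmissionTime L u v ≡ just s → label G u v ≡ just s
transmissionTime-sound {L = L} {u} {v} c eq with L u in Lu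
... | just (w , s) with w ≟ v | u ≟ v
...   | yes refl | no u≢v with Consistent.cause c u v s Lu
...     | inj₁ (v≡u , _) = contradiction (sym v≡u) u≢v
...     | inj₂ (_ , uv)  = trans uv eq

transmissionTime-complete : ∀ {L : Log n} {u v s} → L u ≡ just (v , s) → u ≢ v →
                            transmissionTime L u v ≡ just s
transmissionTime-complete {u = u} {v} Lu u≢v rewrite Lu with v ≟ v | u ≟ v
... | yes _   | no _    = refl
... | yes _   | yes u≡v = contradiction u≡v u≢v
... | no v≢v  | _       = contradiction refl v≢v

TransmittedIn : Fin n → Fin n → ℕ → Query n k × Log n → Set
TransmittedIn u v s (_ , L) = transmissionTime L u v ≡ just s

readLabel : History n k → Labelling n
readLabel []            u v = nothing
readLabel ((_ , L) ∷ h) u v = transmissionTime L u v <∣> readLabel h u v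

module _ {G : TemporalGraph n T} where

  readLabel-sound : ∀ {h : History n k} {u v s} → ConsistentWithAll δ G h →
                    readLabel h u v ≡ just s → label G u v ≡ just s
  readLabel-sound {h = (_ , L) ∷ _} {u} {v} (c ∷ cs) eq with transmissionTime L u v in tr
  ... | just _  = transmissionTime-sound c (trans tr eq)
  ... | nothing = readLabel-sound cs eq

  readLabel-complete : ∀ {h : History n k} {u v s} → ConsistentWithAll δ G h →
                       label G u v ≡ just s → Any (TransmittedIn u v s) h → readLabel h u v ≡ just s
  readLabel-complete {h = (_ , L) ∷ _} {u} {v} (c ∷ cs) uv found with transmissionTime L u v in tr | found
  ... | just _  | _            = trans (sym (transmissionTime-sound c tr)) uv
  ... | nothing | here tr′     = contradiction (trans (sym tr) tr′) λ ()
  ... | nothing | there found′ = readLabel-complete cs uv found′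

  readLabel-correct : ∀ {h : History n k} → ConsistentWithAll δ G h →
                      (∀ {u v s} → label G u v ≡ just s → Any (TransmittedIn u v s) h) →
                      SameGraph (readLabel h) (label G)
  readLabel-correct {h = h} cs covered u v with label G u v in uv
  ... | just s  = readLabel-complete cs uv (covered uv)
  ... | nothing with readLabel h u v in read
  ...   | nothing = refl
  ...   | just s  = contradiction (trans (sym uv) (readLabel-sound cs read)) λ ()

Asked : Seed n → History n k → Set
Asked s = Any (λ e → proj₁ (proj₁ e) ≡ s ∷ [])

module _ {G : TemporalGraph n T} (1≤δ : 1 ≤ δ) where

  edge-transmitted : ∀ {h : History n k} {u v t} → ConsistentWithAll δ G h → Asked (v , t) h →
                     label G u v ≡ just (suc t) → Any (TransmittedIn u v (suc t)) h
  edge-transmitted {h = (_ , L) ∷ _} (c ∷ _) (here refl) uv =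
    here (transmissionTime-complete {L = L} (SingleSeed.neighbour-infected-by-seed c 1≤δ uv)
                                            (label⇒≢ G uv))
  edge-transmitted (_ ∷ cs) (there asked) uv = there (edge-transmitted cs asked uv)

  edges-transmitted : ∀ {h : History n k} → ConsistentWithAll δ G h →
                      (∀ v {t} → t < T → Asked (v , t) h) →
                      ∀ {u v s} → label G u v ≡ just s → Any (TransmittedIn u v s) h
  edges-transmitted cs asked uv with inRange G _ _ _ uv
  ... | s≤s z≤n , t<T = edge-transmitted cs (asked _ t<T) uv

module Scripted (1≤k : 1 ≤ k) (script : List (Seed n)) (final : History n k → Labelling n) where

  single : Seed n → Query n k
  single s = s ∷ [] , 1≤k

  next : List (Seed n) → History n k → Query n k ⊎ Labelling n
  next []      h = inj₂ (final h)
  next (s ∷ _) h = inj₁ (single s)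

  discoverer : Discoverer n k
  discoverer h = next (drop (length h) script) h

  module _ (α : Adversary n k) where

    run : History n k → List (Seed n) → History n k
    run h []       = h
    run h (s ∷ ss) = run ((single s , α h (single s)) ∷ h) ss

    play-run : ∀ h ss → drop (length h) script ≡ ss →
               play (length ss) discoverer α h ≡ just (run h ss , final (run h ss))
    play-run h []       rest = play-submit discoverer α 0 (cong (λ r → next r h) rest)
    play-run h (s ∷ ss) rest = trans (play-query discoverer α (length ss) (cong (λ r → next r h) rest))
                                     (play-run _ ss (drop-suc-∷ (length h) rest))

    run-keeps : ∀ {s} h ss → Asked s h → Asked s (run h ss)
    run-keeps h []       asked = asked
    run-keeps h (_ ∷ ss) asked = run-keeps _ ss (there asked)

    run-asks : ∀ {s} h ss → s ∈ ss → Asked s (run h ss)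
    run-asks h (_ ∷ ss) (here refl) = run-keeps _ ss (here refl)
    run-asks h (_ ∷ ss) (there s∈ss) = run-asks _ ss s∈ss

theorem12 : (n T δ k : ℕ) → 1 ≤ δ → 1 ≤ k →
    Σ (Discoverer n k) λ σ →
      ∀ (G : TemporalGraph n T) (α : Adversary n k) →
        AnswersBy δ G α →
        WinsWithin T δ (n * T) σ α
theorem12 n T δ k 1≤δ 1≤k = discoverer , wins
  where
  seeds : List (Seed n)
  seeds = cartesianProduct (allFin n) (upTo T)

  seeds-length : length seeds ≡ n * T
  seeds-length = trans (length-cartesianProduct (allFin n) (upTo T))
                       (cong₂ _*_ (length-tabulate {n = n} (λ i → i)) (length-upTo T))

  open Scripted 1≤k seeds readLabel

  wins : ∀ (G : TemporalGraph n T) α → AnswersBy δ G α → WinsWithin T δ (n * T) discoverer α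
  wins _ α _ = (h , readLabel h) , played ,
               λ _ cs → readLabel-correct cs (edges-transmitted 1≤δ cs asked)
    where
    h : History n k
    h = run α [] seeds

    played : play (n * T) discoverer α [] ≡ just (h , readLabel h)
    played = subst (λ r → play r discoverer α [] ≡ just (h , readLabel h)) seeds-length
                   (play-run α [] seeds refl)

    asked : ∀ v {t} → t < T → Asked (v , t) h
    asked v t<T = run-asks α [] seeds (∈-cartesianProduct⁺ (∈-allFin v) (∈-upTo⁺ t<T))
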